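{- Let $n\ge3$ be an integer, ${\mathrm T}_m=\binom{m+1}{2}$, and ${\mathcal T}_n=\langle {\mathrm T}_n,{\mathrm T}_{n+1},{\mathrm T}_{n+2}\rangle$. A minimal presentation of ${\mathcal T}_n$ is: (1) if $n$ is odd: $\left\{ \big(\tfrac{n+1}{2}x_3,\tfrac{n+3}{2}x_2\big), \big(nx_2,(n+2)x_1\big) \right\}$; (2) if $n$ is even: $\left\{ \big((n+1)x_3,(n+3)x_2\big), \big(\tfrac{n}{2}x_2,\tfrac{n+2}{2}x_1\big) \right\}$.
   Context: For $n\ge3$, $\{{\mathrm T}_n,{\mathrm T}_{n+1},{\mathrm T}_{n+2}\}$ is the minimal system of generators of ${\mathcal T}_n$. Let $\varphi:\mathbb N^3\to{\mathcal T}_n$, $\varphi(u_1,u_2,u_3)=u_1{\mathrm T}_n+u_2{\mathrm T}_{n+1}+u_3{\mathrm T}_{n+2}$, and let $\sim$ be its kernel congruence on $\mathbb N^3$ ($u\sim v$ iff $\varphi(u)=\varphi(v)$). Here $x_1,x_2,x_3$ are the standard unit vectors of $\mathbb N^3$, so e.g. $(a x_3, b x_2)$ denotes the pair $((0,0,a),(0,b,0))\in\mathbb N^3\times\mathbb N^3$. For $\rho\subseteq \mathbb N^3\times\mathbb N^3$, the congruence generated by $\rho$ is the intersection of all congruences on the monoid $\mathbb N^3$ containing $\rho$. A presentation of ${\mathcal T}_n$ is a set $\rho$ generating $\sim$, and a minimal presentation is a presentation no proper subset of which is a presentation (for numerical semigroups this coincides with minimality of cardinality). -}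

module Defs where

open import Level using (Level; _⊔_) renaming (suc to lsuc; zero to lzero)
open import Data.Nat using (ℕ; suc; _+_; _*_; _≤_)
open import Data.Nat.Combinatorics using (_C_)
open import Data.Product using (_×_; _,_)
open import Data.Sum using (_⊎_)
open import Relation.Nullary using (¬_)
open import Relation.Binary.PropositionalEquality using (_≡_)

T : ℕ → ℕ
T m = suc m C 2

ℕ³ : Set
ℕ³ = ℕ × ℕ × ℕ

_⊕_ : ℕ³ → ℕ³ → ℕ³
(a₁ , a₂ , a₃) ⊕ (b₁ , b₂ , b₃) = (a₁ + b₁ , a₂ + b₂ , a₃ + b₃)

_x₁ _x₂ _x₃ : ℕ → ℕ³
a x₁ = (a , 0 , 0)
a x₂ = (0 , a , 0)
a x₃ = (0 , 0 , a)

φ : ℕ → ℕ³ → ℕ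
φ n (u₁ , u₂ , u₃) = u₁ * T n + u₂ * T (suc n) + u₃ * T (suc (suc n))

_∼[_]_ : ℕ³ → ℕ → ℕ³ → Set
u ∼[ n ] v = φ n u ≡ φ n v

Rel³ : Set₁
Rel³ = ℕ³ → ℕ³ → Set

PairSet : Set₁
PairSet = ℕ³ × ℕ³ → Set

record IsCongruence (R : Rel³) : Set where
  field
    refl′  : ∀ u → R u u
    sym′   : ∀ {u v} → R u v → R v u
    trans′ : ∀ {u v w} → R u v → R v w → R u w
    compat : ∀ {a b c d} → R a b → R c d → R (a ⊕ c) (b ⊕ d)

Generated : PairSet → ℕ³ → ℕ³ → Set₁
Generated ρ u v = (R : Rel³) → IsCongruence R → (∀ {a b} → ρ (a , b) → R a b) → R u v

IsPresentation : ℕ → PairSet → Set₁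
IsPresentation n ρ = (u v : ℕ³) → (Generated ρ u v → u ∼[ n ] v) × (u ∼[ n ] v → Generated ρ u v)

_⊆ₚ_ : PairSet → PairSet → Set
σ ⊆ₚ ρ = ∀ {p} → σ p → ρ p

IsMinimalPresentation : ℕ → PairSet → Set₁
IsMinimalPresentation n ρ =
  IsPresentation n ρ × ((σ : PairSet) → σ ⊆ₚ ρ → ¬ (ρ ⊆ₚ σ) → ¬ IsPresentation n σ)

｛_,_｝ : ℕ³ × ℕ³ → ℕ³ × ℕ³ → PairSet
｛ p , q ｝ r = r ≡ p ⊎ r ≡ q

module Submission where

open import Defs
open import Data.Nat using (ℕ; _+_; _*_; _≤_)
open import Data.Product using (_×_; _,_)
open import Relation.Binary.PropositionalEquality using (_≡_)
open import Data.Product using (proj₁; proj₂)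
open import Data.Nat using (zero; suc; _<_; _/_; _%_; NonZero; ≢-nonZero⁻¹)
open import Data.Nat.Properties
  using ( +-identityʳ; +-comm; *-comm; *-zeroʳ; *-distribˡ-+; m*n≢0
        ; +-cancelˡ-≡; +-cancelʳ-≡; *-cancelˡ-≡; *-cancelʳ-≡)
open import Data.Nat.DivMod using (m≡m%n+[m/n]*n; [m+kn]%n≡m%n; m<n⇒m%n≡m; m%n<n)
open import Data.Nat.Combinatorics using (nC1≡n; nCk+nC[k+1]≡[n+1]C[k+1])
open import Data.Nat.Tactic.RingSolver using (solve)
open import Data.List using (_∷_; [])
open import Data.Sum using (_⊎_; inj₁; inj₂; [_,_]′; map₁; map₂; swap)
open import Function using (id)
open import Relation.Nullary using (¬_; contradiction)
open import Relation.Binary.PropositionalEquality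
  using (refl; sym; trans; cong; cong₂; subst; module ≡-Reasoning)

-- Reducing the x₃-coordinate modulo A with the first relation and then the
-- x₂-coordinate modulo M with the second one brings every u ∈ ℕ³ to a normal
-- form in the box u₂ < M, u₃ < A; on that box φ is injective (its value is a
-- two-digit mixed-radix expansion of (u₃, u₂)), so the two relations
-- generate ∼. Neither can be dropped: the linear form (M, C, 0) is constant
-- on the second relation but not on the first, and (0, A, B) the other way
-- round, so the kernel of either form, enlarged to everything when the
-- separated relation is present, is a congruence containing any subset of
-- the presentation that omits that relation.

lin : ℕ³ → ℕ³ → ℕ
lin (w₁ , w₂ , w₃) (u₁ , u₂ , u₃) = u₁ * w₁ + u₂ * w₂ + u₃ * w₃

lin-x₁ : ∀ w a → lin w (a x₁) ≡ a * proj₁ w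
lin-x₁ (w₁ , w₂ , w₃) a = trans (+-identityʳ (a * w₁ + 0)) (+-identityʳ (a * w₁))

lin-x₂ : ∀ w a → lin w (a x₂) ≡ a * proj₁ (proj₂ w)
lin-x₂ (w₁ , w₂ , w₃) a = +-identityʳ (a * w₂)

lin-x₃ : ∀ w a → lin w (a x₃) ≡ a * proj₂ (proj₂ w)
lin-x₃ w a = refl

lin-⊕ : ∀ w u v → lin w (u ⊕ v) ≡ lin w u + lin w v
lin-⊕ (w₁ , w₂ , w₃) (u₁ , u₂ , u₃) (v₁ , v₂ , v₃) = distrib
  where
  distrib : (u₁ + v₁) * w₁ + (u₂ + v₂) * w₂ + (u₃ + v₃) * w₃
          ≡ (u₁ * w₁ + u₂ * w₂ + u₃ * w₃) + (v₁ * w₁ + v₂ * w₂ + v₃ * w₃)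
  distrib = solve (w₁ ∷ w₂ ∷ w₃ ∷ u₁ ∷ u₂ ∷ u₃ ∷ v₁ ∷ v₂ ∷ v₃ ∷ [])

kernel : ℕ³ → Rel³
kernel w u v = lin w u ≡ lin w v

kernel-compat : ∀ w {a b c d} → kernel w a b → kernel w c d → kernel w (a ⊕ c) (b ⊕ d)
kernel-compat w {a} {b} {c} {d} a~b c~d = begin
  lin w (a ⊕ c)      ≡⟨ lin-⊕ w a c ⟩
  lin w a + lin w c  ≡⟨ cong₂ _+_ a~b c~d ⟩
  lin w b + lin w d  ≡⟨ sym (lin-⊕ w b d) ⟩
  lin w (b ⊕ d)      ∎
  where open ≡-Reasoning

kernel-isCongruence : ∀ w → IsCongruence (kernel w)
kernel-isCongruence w = record
  { refl′ = λ _ → refl ; sym′ = sym ; trans′ = trans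
  ; compat = λ {a} {b} {c} {d} → kernel-compat w {a} {b} {c} {d} }

kernel-unless : Set → ℕ³ → Rel³
kernel-unless S w u v = S ⊎ kernel w u v

kernel-unless-isCongruence : ∀ S w → IsCongruence (kernel-unless S w)
kernel-unless-isCongruence S w = record
  { refl′ = λ _ → inj₂ refl ; sym′ = map₂ sym
  ; trans′ = λ {u} {v} {x} → transitive {u} {v} {x}
  ; compat = λ {a} {b} {c} {d} → compatible {a} {b} {c} {d} }
  where
  transitive : ∀ {u v x} → kernel-unless S w u v → kernel-unless S w v x → kernel-unless S w u x
  transitive (inj₁ s) _ = inj₁ s
  transitive (inj₂ _) (inj₁ s) = inj₁ s
  transitive (inj₂ e) (inj₂ e′) = inj₂ (trans e e′)
  compatible : ∀ {a b c d} → kernel-unless S w a b → kernel-unless S w c d →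
               kernel-unless S w (a ⊕ c) (b ⊕ d)
  compatible (inj₁ s) _ = inj₁ s
  compatible (inj₂ _) (inj₁ s) = inj₁ s
  compatible {a} {b} {c} {d} (inj₂ e) (inj₂ e′) = inj₂ (kernel-compat w {a} {b} {c} {d} e e′)

weights : ℕ → ℕ³
weights n = (T n , T (suc n) , T (suc (suc n)))

generated⇒∼ : ∀ {n ρ u v} → (∀ {a b} → ρ (a , b) → a ∼[ n ] b) → Generated ρ u v → u ∼[ n ] v
generated⇒∼ {n} ρ⊆∼ g = g (kernel (weights n)) (kernel-isCongruence (weights n)) ρ⊆∼

presentation⇒∼ : ∀ {n ρ a b} → IsPresentation n ρ → ρ (a , b) → a ∼[ n ] b
presentation⇒∼ {a = a} {b} pres ρab = proj₁ (pres a b) (λ _ _ ρ⊆R → ρ⊆R ρab)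

isolated-∈-presentation : ∀ {n σ p₁ p₂} (w : ℕ³) → IsPresentation n σ → p₁ ∼[ n ] p₂ →
  ¬ kernel w p₁ p₂ → (∀ {a b} → σ (a , b) → (a , b) ≡ (p₁ , p₂) ⊎ kernel w a b) →
  σ (p₁ , p₂)
isolated-∈-presentation {σ = σ} {p₁} {p₂} w pres p∼ p∉w σ-cases =
  [ id , (λ p∈w → contradiction p∈w p∉w) ]′ p-related
  where
  σ⊆R : ∀ {a b} → σ (a , b) → kernel-unless (σ (p₁ , p₂)) w a b
  σ⊆R σab = map₁ (λ { refl → σab }) (σ-cases σab)

  p-related : kernel-unless (σ (p₁ , p₂)) w p₁ p₂
  p-related = proj₂ (pres p₁ p₂) p∼ _ (kernel-unless-isCongruence (σ (p₁ , p₂)) w) σ⊆R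

pair-isMinimalPresentation : ∀ {n p₁ p₂ q₁ q₂} (wp wq : ℕ³) →
  IsPresentation n ｛ (p₁ , p₂) , (q₁ , q₂) ｝ →
  ¬ kernel wp p₁ p₂ → kernel wp q₁ q₂ → kernel wq p₁ p₂ → ¬ kernel wq q₁ q₂ →
  IsMinimalPresentation n ｛ (p₁ , p₂) , (q₁ , q₂) ｝
pair-isMinimalPresentation {n} wp wq pres p∉wp q∈wp p∈wq q∉wq =
  pres , λ σ σ⊆ρ ρ⊈σ σ-pres →
    let σp = isolated-∈-presentation {n} wp σ-pres (presentation⇒∼ {n} pres (inj₁ refl)) p∉wp
               (λ σr → map₂ (λ { refl → q∈wp }) (σ⊆ρ σr))
        σq = isolated-∈-presentation {n} wq σ-pres (presentation⇒∼ {n} pres (inj₂ refl)) q∉wq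
               (λ σr → swap (map₁ (λ { refl → p∈wq }) (σ⊆ρ σr)))
    in ρ⊈σ λ { (inj₁ refl) → σp ; (inj₂ refl) → σq }

remainder-quotient-unique : ∀ m .{{_ : NonZero m}} {r r′} q q′ → r < m → r′ < m →
  r + q * m ≡ r′ + q′ * m → r ≡ r′ × q ≡ q′
remainder-quotient-unique m {r} {r′} q q′ r<m r′<m e = r≡r′ , q≡q′
  where
  open ≡-Reasoning
  r≡r′ : r ≡ r′
  r≡r′ = begin
    r                 ≡⟨ sym (m<n⇒m%n≡m r<m) ⟩
    r % m             ≡⟨ sym ([m+kn]%n≡m%n r q m) ⟩
    (r + q * m) % m   ≡⟨ cong (_% m) e ⟩
    (r′ + q′ * m) % m ≡⟨ [m+kn]%n≡m%n r′ q′ m ⟩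
    r′ % m            ≡⟨ m<n⇒m%n≡m r′<m ⟩
    r′                ∎
  q≡q′ : q ≡ q′
  q≡q′ = *-cancelʳ-≡ q q′ m (+-cancelˡ-≡ r (q * m) (q′ * m) (trans e (cong (_+ q′ * m) (sym r≡r′))))

quotient-remainder : ∀ m q .{{_ : NonZero q}} → m ≡ (m / q) * q + m % q
quotient-remainder m q = trans (m≡m%n+[m/n]*n m q) (+-comm (m % q) _)

InBox : ℕ → ℕ → ℕ³ → Set
InBox M A (_ , u₂ , u₃) = u₂ < M × u₃ < A

mixed-radix-injective : ∀ (f : ℕ³ → ℕ) (P : ℕ → ℕ → ℕ) A M c d γ
  .{{_ : NonZero A}} .{{_ : NonZero M}} .{{_ : NonZero c}} →
  (∀ u₁ u₂ u₃ → f (u₁ , u₂ , u₃) ≡ u₃ + (P u₁ u₂ + γ * u₃) * A) →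
  (∀ u₁ u₂ → c * P u₁ u₂ ≡ u₂ + (c * u₁ + d * u₂) * M) →
  ∀ {u v} → InBox M A u → InBox M A v → f u ≡ f v → u ≡ v
mixed-radix-injective f P A M c d γ f-digits P-digits
  {u₁ , u₂ , u₃} {v₁ , v₂ , v₃} (u₂<M , u₃<A) (v₂<M , v₃<A) fu≡fv
  with refl , Pu≡Pv ← remainder-quotient-unique A (P u₁ u₂ + γ * u₃) (P v₁ v₂ + γ * v₃) u₃<A v₃<A
         (trans (sym (f-digits u₁ u₂ u₃)) (trans fu≡fv (f-digits v₁ v₂ v₃)))
  with refl , cu≡cv ← remainder-quotient-unique M (c * u₁ + d * u₂) (c * v₁ + d * v₂) u₂<M v₂<M
         (trans (sym (P-digits u₁ u₂))
           (trans (cong (c *_) (+-cancelʳ-≡ (γ * u₃) _ _ Pu≡Pv)) (P-digits v₁ v₂)))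
  = cong (_, u₂ , u₃) (*-cancelˡ-≡ u₁ v₁ c (+-cancelʳ-≡ (d * u₂) _ _ cu≡cv))

module TwoRelations (n A B M C : ℕ)
  .{{_ : NonZero A}} .{{_ : NonZero B}} .{{_ : NonZero M}} .{{_ : NonZero C}}
  (A₃≡B₂ : A * T (suc (suc n)) ≡ B * T (suc n))
  (M₂≡C₁ : M * T (suc n) ≡ C * T n)
  (box-injective : ∀ {u v} → InBox M A u → InBox M A v → u ∼[ n ] v → u ≡ v)
  where

  ρ : PairSet
  ρ = ｛ (A x₃ , B x₂) , (M x₂ , C x₁) ｝

  normal : ℕ³ → ℕ³
  normal (u₁ , u₂ , u₃) = ((u₂′ / M) * C + u₁ , u₂′ % M , u₃ % A)
    where u₂′ = (u₃ / A) * B + u₂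

  normal-inBox : ∀ u → InBox M A (normal u)
  normal-inBox (u₁ , u₂ , u₃) = m%n<n _ M , m%n<n u₃ A

  module Reduce (R : Rel³) (R-cong : IsCongruence R)
                (A₃RB₂ : R (A x₃) (B x₂)) (M₂RC₁ : R (M x₂) (C x₁)) where
    open IsCongruence R-cong

    R-respˡ : ∀ {u u′ v} → u ≡ u′ → R u v → R u′ v
    R-respˡ {v = v} = subst (λ z → R z v)

    multiples₃ : ∀ q → R ((q * A) x₃) ((q * B) x₂)
    multiples₃ zero = refl′ _
    multiples₃ (suc q) = compat A₃RB₂ (multiples₃ q)

    multiples₂ : ∀ q → R ((q * M) x₂) ((q * C) x₁)
    multiples₂ zero = refl′ _
    multiples₂ (suc q) = compat M₂RC₁ (multiples₂ q)

    reduce₃ : ∀ u₁ u₂ u₃ → R (u₁ , u₂ , u₃) (u₁ , (u₃ / A) * B + u₂ , u₃ % A)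
    reduce₃ u₁ u₂ u₃ = R-respˡ (cong (λ z → u₁ , u₂ , z) (sym (quotient-remainder u₃ A)))
      (compat (multiples₃ (u₃ / A)) (refl′ (u₁ , u₂ , u₃ % A)))

    reduce₂ : ∀ u₁ u₂ u₃ → R (u₁ , u₂ , u₃) ((u₂ / M) * C + u₁ , u₂ % M , u₃)
    reduce₂ u₁ u₂ u₃ = R-respˡ (cong (λ z → u₁ , z , u₃) (sym (quotient-remainder u₂ M)))
      (compat (multiples₂ (u₂ / M)) (refl′ (u₁ , u₂ % M , u₃)))

    reduce : ∀ u → R u (normal u)
    reduce (u₁ , u₂ , u₃) = trans′ (reduce₃ u₁ u₂ u₃) (reduce₂ u₁ _ (u₃ % A))

  ρ⊆∼ : ∀ {a b} → ρ (a , b) → a ∼[ n ] b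
  ρ⊆∼ (inj₁ refl) = trans (lin-x₃ (weights n) A) (trans A₃≡B₂ (sym (lin-x₂ (weights n) B)))
  ρ⊆∼ (inj₂ refl) = trans (lin-x₂ (weights n) M) (trans M₂≡C₁ (sym (lin-x₁ (weights n) C)))

  isPresentation : IsPresentation n ρ
  isPresentation u v = generated⇒∼ {n} ρ⊆∼ , ∼⇒generated
    where
    ∼-normal : ∀ w → w ∼[ n ] normal w
    ∼-normal = Reduce.reduce _ (kernel-isCongruence (weights n)) (ρ⊆∼ (inj₁ refl)) (ρ⊆∼ (inj₂ refl))

    ∼⇒generated : u ∼[ n ] v → Generated ρ u v
    ∼⇒generated u∼v R R-cong ρ⊆R = trans′ (reduce u)
      (R-respˡ (sym normal-u≡normal-v) (sym′ (reduce v)))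
      where
      open IsCongruence R-cong
      open Reduce R R-cong (ρ⊆R (inj₁ refl)) (ρ⊆R (inj₂ refl))
      normal-u≡normal-v : normal u ≡ normal v
      normal-u≡normal-v = box-injective (normal-inBox u) (normal-inBox v)
        (trans (sym (∼-normal u)) (trans u∼v (∼-normal v)))

  isMinimalPresentation : IsMinimalPresentation n ρ
  isMinimalPresentation =
    pair-isMinimalPresentation {n} wp wq isPresentation p∉wp q∈wp p∈wq q∉wq
    where
    open ≡-Reasoning
    wp wq : ℕ³
    wp = (M , C , 0)
    wq = (0 , A , B)

    p∉wp : ¬ kernel wp (A x₃) (B x₂)
    p∉wp e = ≢-nonZero⁻¹ (B * C) {{m*n≢0 B C}} (begin
      B * C          ≡⟨ sym (lin-x₂ wp B) ⟩
      lin wp (B x₂)  ≡⟨ sym e ⟩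
      A * 0          ≡⟨ *-zeroʳ A ⟩
      0              ∎)

    q∈wp : kernel wp (M x₂) (C x₁)
    q∈wp = begin
      lin wp (M x₂)  ≡⟨ lin-x₂ wp M ⟩
      M * C          ≡⟨ *-comm M C ⟩
      C * M          ≡⟨ sym (lin-x₁ wp C) ⟩
      lin wp (C x₁)  ∎

    p∈wq : kernel wq (A x₃) (B x₂)
    p∈wq = trans (*-comm A B) (sym (lin-x₂ wq B))

    q∉wq : ¬ kernel wq (M x₂) (C x₁)
    q∉wq e = ≢-nonZero⁻¹ (M * A) {{m*n≢0 M A}} (begin
      M * A          ≡⟨ sym (lin-x₂ wq M) ⟩
      lin wq (M x₂)  ≡⟨ e ⟩
      lin wq (C x₁)  ≡⟨ lin-x₁ wq C ⟩
      C * 0          ≡⟨ *-zeroʳ C ⟩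
      0              ∎)

T-suc : ∀ m → T (suc m) ≡ suc m + T m
T-suc m = trans (sym (nCk+nC[k+1]≡[n+1]C[k+1] (suc m) 1)) (cong (_+ T m) (nC1≡n (suc m)))

double-T : ∀ m → 2 * T m ≡ m * suc m
double-T zero = refl
double-T (suc m) = begin
  2 * T (suc m)              ≡⟨ cong (2 *_) (T-suc m) ⟩
  2 * (suc m + T m)          ≡⟨ *-distribˡ-+ 2 (suc m) (T m) ⟩
  2 * suc m + 2 * T m        ≡⟨ cong (2 * suc m +_) (double-T m) ⟩
  2 * suc m + m * suc m      ≡⟨ solve (m ∷ []) ⟩
  suc m * suc (suc m)        ∎
  where open ≡-Reasoning

T-from-double : ∀ m x → m * suc m ≡ 2 * x → T m ≡ x
T-from-double m x e = *-cancelˡ-≡ (T m) x 2 (trans (double-T m) e)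

nonZero-+ : ∀ m n .{{_ : NonZero n}} → NonZero (m + n)
nonZero-+ zero (suc n) = _
nonZero-+ (suc m) n = _

module Odd (k : ℕ) where
  instance
    _ : NonZero (k + 1)
    _ = nonZero-+ k 1
    _ : NonZero (k + 2)
    _ = nonZero-+ k 2
    _ : NonZero (2 * k + 1)
    _ = nonZero-+ (2 * k) 1
    _ : NonZero (2 * k + 1 + 2)
    _ = nonZero-+ (2 * k + 1) 2

  T₀ : T (2 * k + 1) ≡ (k + 1) * (2 * k + 1)
  T₀ = T-from-double (2 * k + 1) _ (solve (k ∷ []))

  T₁ : T (suc (2 * k + 1)) ≡ (k + 1) * (2 * k + 3)
  T₁ = T-from-double (suc (2 * k + 1)) _ (solve (k ∷ []))

  T₂ : T (suc (suc (2 * k + 1))) ≡ (2 * k + 3) * (k + 2)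
  T₂ = T-from-double (suc (suc (2 * k + 1))) _ (solve (k ∷ []))

  relation₃₂ : (k + 1) * T (suc (suc (2 * k + 1))) ≡ (k + 2) * T (suc (2 * k + 1))
  relation₃₂ rewrite T₁ | T₂ = solve (k ∷ [])

  relation₂₁ : (2 * k + 1) * T (suc (2 * k + 1)) ≡ (2 * k + 1 + 2) * T (2 * k + 1)
  relation₂₁ rewrite T₀ | T₁ = solve (k ∷ [])

  φ-digits : ∀ u₁ u₂ u₃ → φ (2 * k + 1) (u₁ , u₂ , u₃)
    ≡ u₃ + ((2 * k + 1) * u₁ + (2 * k + 3) * u₂ + (2 * k + 5) * u₃) * (k + 1)
  φ-digits u₁ u₂ u₃ rewrite T₀ | T₁ | T₂ = solve (k ∷ u₁ ∷ u₂ ∷ u₃ ∷ [])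

  -- k + 1 is the inverse of 2 modulo 2k + 1.
  quotient-digits : ∀ u₁ u₂ → (k + 1) * ((2 * k + 1) * u₁ + (2 * k + 3) * u₂)
    ≡ u₂ + ((k + 1) * u₁ + (k + 2) * u₂) * (2 * k + 1)
  quotient-digits u₁ u₂ = solve (k ∷ u₁ ∷ u₂ ∷ [])

  isMinimalPresentation : IsMinimalPresentation (2 * k + 1)
    ｛ ((k + 1) x₃ , (k + 2) x₂) , ((2 * k + 1) x₂ , (2 * k + 1 + 2) x₁) ｝
  isMinimalPresentation =
    TwoRelations.isMinimalPresentation (2 * k + 1) (k + 1) (k + 2) (2 * k + 1) (2 * k + 1 + 2)
      relation₃₂ relation₂₁
      (mixed-radix-injective (φ (2 * k + 1)) (λ u₁ u₂ → (2 * k + 1) * u₁ + (2 * k + 3) * u₂)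
        (k + 1) (2 * k + 1) (k + 1) (k + 2) (2 * k + 5) φ-digits quotient-digits)

module Even (k : ℕ) .{{_ : NonZero k}} where
  instance
    _ : NonZero (k + 1)
    _ = nonZero-+ k 1
    _ : NonZero (2 * k + 1)
    _ = nonZero-+ (2 * k) 1
    _ : NonZero (2 * k + 3)
    _ = nonZero-+ (2 * k) 3

  T₀ : T (2 * k) ≡ k * (2 * k + 1)
  T₀ = T-from-double (2 * k) _ (solve (k ∷ []))

  T₁ : T (suc (2 * k)) ≡ (k + 1) * (2 * k + 1)
  T₁ = T-from-double (suc (2 * k)) _ (solve (k ∷ []))

  T₂ : T (suc (suc (2 * k))) ≡ (k + 1) * (2 * k + 3)
  T₂ = T-from-double (suc (suc (2 * k))) _ (solve (k ∷ []))

  relation₃₂ : (2 * k + 1) * T (suc (suc (2 * k))) ≡ (2 * k + 3) * T (suc (2 * k))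
  relation₃₂ rewrite T₁ | T₂ = solve (k ∷ [])

  relation₂₁ : k * T (suc (2 * k)) ≡ (k + 1) * T (2 * k)
  relation₂₁ rewrite T₀ | T₁ = solve (k ∷ [])

  φ-digits : ∀ u₁ u₂ u₃ → φ (2 * k) (u₁ , u₂ , u₃)
    ≡ u₃ + (k * u₁ + (k + 1) * u₂ + (k + 2) * u₃) * (2 * k + 1)
  φ-digits u₁ u₂ u₃ rewrite T₀ | T₁ | T₂ = solve (k ∷ u₁ ∷ u₂ ∷ u₃ ∷ [])

  quotient-digits : ∀ u₁ u₂ → 1 * (k * u₁ + (k + 1) * u₂) ≡ u₂ + (1 * u₁ + 1 * u₂) * k
  quotient-digits u₁ u₂ = solve (k ∷ u₁ ∷ u₂ ∷ [])

  isMinimalPresentation : IsMinimalPresentation (2 * k)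
    ｛ ((2 * k + 1) x₃ , (2 * k + 3) x₂) , (k x₂ , (k + 1) x₁) ｝
  isMinimalPresentation =
    TwoRelations.isMinimalPresentation (2 * k) (2 * k + 1) (2 * k + 3) k (k + 1)
      relation₃₂ relation₂₁
      (mixed-radix-injective (φ (2 * k)) (λ u₁ u₂ → k * u₁ + (k + 1) * u₂)
        (2 * k + 1) k 1 1 (k + 2) φ-digits quotient-digits)

proposition25 : (n : ℕ) → 3 ≤ n →
    ((k : ℕ) → n ≡ 2 * k + 1 →
      IsMinimalPresentation n ｛ ((k + 1) x₃ , (k + 2) x₂) , (n x₂ , (n + 2) x₁) ｝)
    × ((k : ℕ) → n ≡ 2 * k →
      IsMinimalPresentation n ｛ ((n + 1) x₃ , (n + 3) x₂) , (k x₂ , (k + 1) x₁) ｝)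
proposition25 n 3≤n =
    (λ { k refl → Odd.isMinimalPresentation k })
  , (λ { zero refl → contradiction 3≤n λ ()
       ; (suc k) refl → Even.isMinimalPresentation (suc k) })
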